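{- Let $k = k_1 + k_2 + \dots + k_s$ with $s \geq 2$ and all $k_i > 0$ integers. Call a triple $(a,b,c)$ of nonnegative integers a uniform $m$-palette if $a+b+c=m$ and $a,b,c \leq \lceil m/2\rceil$. Then every uniform $k$-palette $(a,b,c)$ can be partitioned into $s$ uniform palettes of cardinalities $k_1,\dots,k_s$ respectively; that is, there exist uniform $k_i$-palettes $(a_i,b_i,c_i)$, $i=1,\dots,s$, with $\sum_{i=1}^s a_i = a$, $\sum_{i=1}^s b_i = b$, $\sum_{i=1}^s c_i = c$.
   Context: A triple $(a,b,c)$ represents a multiset of colors from three colors (red, blue, green) with $a$ reds, $b$ blues and $c$ greens. -}

module Defs where

open import Data.Nat using (ℕ; zero; suc; _+_; _≤_; ⌈_/2⌉)
open import Data.Fin using (Fin)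
import Data.Fin as F
open import Data.Product using (_×_)
open import Relation.Binary.PropositionalEquality using (_≡_)

record UniformPalette (m a b c : ℕ) : Set where
  field
    total : a + b + c ≡ m
    a≤ : a ≤ ⌈ m /2⌉
    b≤ : b ≤ ⌈ m /2⌉
    c≤ : c ≤ ⌈ m /2⌉


sumFin : ∀ {s} → (Fin s → ℕ) → ℕ
sumFin {zero} f = 0
sumFin {suc s} f = f F.zero + sumFin (λ i → f (F.suc i))

-- Split off the two most frequent colours, one ball each, and recurse. Removing (1,1,0)
-- lowers the size by 2 and the bound ⌈m/2⌉ by 1; the smallest count stays within the new
-- bound because it is at most each of the other two, and when m ≥ 2 the two largest counts
-- are positive since no count exceeds ⌈m/2⌉ < m. An odd size is handled by removing one
-- ball of the most frequent colour.
module Submission where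

open import Defs
open import Data.Nat using (ℕ; zero; suc; _+_; _≤_; _<_; z≤n; s≤s; s≤s⁻¹; ⌈_/2⌉; ⌊_/2⌋)
open import Data.Nat.Properties
open import Algebra.Properties.CommutativeSemigroup +-commutativeSemigroup
  using (xy∙z≈xz∙y; interchange)
open import Data.Fin using (Fin)
import Data.Fin as Fin
open import Data.Vec.Functional using (_∷_)
open import Data.Product using (Σ; _×_; _,_)
open import Data.Sum using (inj₁; inj₂; [_,_]′)
open import Function using (_∘_)
open import Relation.Nullary using (contradiction)
open import Relation.Binary.PropositionalEquality
  using (_≡_; refl; sym; trans; cong; cong₂; subst; module ≡-Reasoning)

open UniformPalette

m+m≤n⇒m≤⌊n/2⌋ : ∀ {m n} → m + m ≤ n → m ≤ ⌊ n /2⌋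
m+m≤n⇒m≤⌊n/2⌋ {m} {n} m+m≤n = subst (_≤ ⌊ n /2⌋) (sym (n≡⌊n+n/2⌋ m)) (⌊n/2⌋-mono m+m≤n)

wlog-sorted : (P : ℕ → ℕ → ℕ → Set) →
  (∀ {a b c} → P a b c → P b a c) → (∀ {a b c} → P a b c → P a c b) →
  (∀ {a b c} → b ≤ a → c ≤ b → P a b c) → ∀ a b c → P a b c
wlog-sorted P swap₁₂ swap₂₃ sorted a b c =
  [ largest-first , swap₁₂ ∘ largest-first ]′ (≤-total b a)
  where
  largest-first : ∀ {a b} → b ≤ a → P a b c
  largest-first {a} {b} b≤a with ≤-total c b | ≤-total c a
  ... | inj₁ c≤b | _        = sorted b≤a c≤b
  ... | inj₂ b≤c | inj₁ c≤a = swap₂₃ (sorted c≤a b≤c)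
  ... | inj₂ b≤c | inj₂ a≤c = swap₂₃ (swap₁₂ (sorted a≤c b≤a))

palette-swap₁₂ : ∀ {m a b c} → UniformPalette m a b c → UniformPalette m b a c
palette-swap₁₂ {a = a} {b} {c} p = record
  { total = trans (cong (_+ c) (+-comm b a)) (total p)
  ; a≤ = b≤ p ; b≤ = a≤ p ; c≤ = c≤ p }

palette-swap₂₃ : ∀ {m a b c} → UniformPalette m a b c → UniformPalette m a c b
palette-swap₂₃ {a = a} {b} {c} p = record
  { total = trans (xy∙z≈xz∙y a c b) (total p)
  ; a≤ = a≤ p ; b≤ = c≤ p ; c≤ = b≤ p }

palette-zero : ∀ {a b c} → UniformPalette 0 a b c → a ≡ 0 × b ≡ 0 × c ≡ 0
palette-zero p = n≤0⇒n≡0 (a≤ p) , n≤0⇒n≡0 (b≤ p) , n≤0⇒n≡0 (c≤ p)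

palette-+₂ : ∀ {m x y z a b c} → UniformPalette 2 x y z → UniformPalette m a b c →
  UniformPalette (2 + m) (x + a) (y + b) (z + c)
palette-+₂ {m} {x} {y} {z} {a} {b} {c} p q = record
  { total = begin
      x + a + (y + b) + (z + c) ≡⟨ cong (_+ (z + c)) (interchange x a y b) ⟩
      x + y + (a + b) + (z + c) ≡⟨ interchange (x + y) (a + b) z c ⟩
      x + y + z + (a + b + c)   ≡⟨ cong₂ _+_ (total p) (total q) ⟩
      2 + m                     ∎
  ; a≤ = +-mono-≤ (a≤ p) (a≤ q) ; b≤ = +-mono-≤ (b≤ p) (b≤ q) ; c≤ = +-mono-≤ (c≤ p) (c≤ q) }
  where open ≡-Reasoning

record Split (m n a b c : ℕ) : Set where
  field
    a₁ b₁ c₁ a₂ b₂ c₂ : ℕ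
    first  : UniformPalette m a₁ b₁ c₁
    second : UniformPalette n a₂ b₂ c₂
    sum-a  : a₁ + a₂ ≡ a
    sum-b  : b₁ + b₂ ≡ b
    sum-c  : c₁ + c₂ ≡ c

split-swap₁₂ : ∀ {m n a b c} → Split m n a b c → Split m n b a c
split-swap₁₂ S = record
  { first = palette-swap₁₂ first ; second = palette-swap₁₂ second
  ; sum-a = sum-b ; sum-b = sum-a ; sum-c = sum-c }
  where open Split S

split-swap₂₃ : ∀ {m n a b c} → Split m n a b c → Split m n a c b
split-swap₂₃ S = record
  { first = palette-swap₂₃ first ; second = palette-swap₂₃ second
  ; sum-a = sum-a ; sum-b = sum-c ; sum-c = sum-b }
  where open Split S

SplitsOff : ℕ → ℕ → ℕ → ℕ → ℕ → Set
SplitsOff m n a b c = UniformPalette (m + n) a b c → Split m n a b c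

splitsOff-wlog-sorted : ∀ {m n} → (∀ {a b c} → b ≤ a → c ≤ b → SplitsOff m n a b c) →
  ∀ a b c → SplitsOff m n a b c
splitsOff-wlog-sorted {m} {n} = wlog-sorted (SplitsOff m n)
  (λ f → split-swap₁₂ ∘ f ∘ palette-swap₁₂)
  (λ f → split-swap₂₃ ∘ f ∘ palette-swap₂₃)

split-off-largest : ∀ {n a b c} → b ≤ a → c ≤ b → SplitsOff 1 n a b c
split-off-largest {a = zero} z≤n z≤n p = contradiction (total p) 0≢1+n
split-off-largest {n} {suc a} {b} {c} b≤a c≤b p = record
  { a₁ = 1 ; b₁ = 0 ; c₁ = 0 ; a₂ = a ; b₂ = b ; c₂ = c
  ; first  = record { total = refl ; a≤ = ≤-refl ; b≤ = z≤n ; c≤ = z≤n }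
  ; second = record
    { total = suc-injective (total p)
    ; a≤ = ≤-trans (s≤s⁻¹ (a≤ p)) (⌊n/2⌋≤⌈n/2⌉ n)
    ; b≤ = b≤⌈n/2⌉
    ; c≤ = ≤-trans c≤b b≤⌈n/2⌉ }
  ; sum-a = refl ; sum-b = refl ; sum-c = refl }
  where
  open ≤-Reasoning
  b≤⌈n/2⌉ : b ≤ ⌈ n /2⌉
  b≤⌈n/2⌉ = m+m≤n⇒m≤⌊n/2⌋ (begin
    b + b         ≤⟨ +-monoˡ-≤ b b≤a ⟩
    suc a + b     ≤⟨ m≤m+n (suc a + b) c ⟩
    suc a + b + c ≡⟨ total p ⟩
    suc n         ∎)

split-off-two-largest : ∀ {n a b c} → b ≤ a → c ≤ b → SplitsOff 2 n a b c
split-off-two-largest {n} {a} {zero} {zero} _ z≤n p =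
  contradiction (subst (_≤ ⌈ 2 + n /2⌉) a≡2+n (a≤ p)) (<⇒≱ (⌈n/2⌉<n n))
  where
  a≡2+n : a ≡ 2 + n
  a≡2+n = trans (sym (trans (+-identityʳ (a + 0)) (+-identityʳ a))) (total p)
split-off-two-largest {n} {suc a} {suc b} {c} (s≤s b≤a) c≤b p = record
  { a₁ = 1 ; b₁ = 1 ; c₁ = 0 ; a₂ = a ; b₂ = b ; c₂ = c
  ; first  = record { total = refl ; a≤ = ≤-refl ; b≤ = ≤-refl ; c≤ = z≤n }
  ; second = record
    { total = total-rest
    ; a≤ = s≤s⁻¹ (a≤ p)
    ; b≤ = s≤s⁻¹ (b≤ p)
    ; c≤ = m+m≤n⇒m≤⌊n/2⌋ (begin
        c + c           ≤⟨ +-monoˡ-≤ c (≤-trans c≤b (s≤s (m≤n+m b a))) ⟩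
        suc (a + b) + c ≡⟨ cong suc total-rest ⟩
        suc n           ∎) }
  ; sum-a = refl ; sum-b = refl ; sum-c = refl }
  where
  open ≤-Reasoning
  total-rest : a + b + c ≡ n
  total-rest = suc-injective (suc-injective
    (trans (cong (λ t → suc (t + c)) (sym (+-suc a b))) (total p)))

split-after-pair : ∀ {m n a b c} (S : Split 2 (m + n) a b c) →
  Split m n (Split.a₂ S) (Split.b₂ S) (Split.c₂ S) → Split (2 + m) n a b c
split-after-pair P S = record
  { first = palette-+₂ P.first S.first ; second = S.second
  ; sum-a = regroup P.a₁ S.sum-a P.sum-a
  ; sum-b = regroup P.b₁ S.sum-b P.sum-b
  ; sum-c = regroup P.c₁ S.sum-c P.sum-c }
  where
  module P = Split P
  module S = Split S
  regroup : ∀ x {y z w u} → y + z ≡ w → x + w ≡ u → x + y + z ≡ u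
  regroup x {y} {z} y+z≡w x+w≡u = trans (+-assoc x y z) (trans (cong (x +_) y+z≡w) x+w≡u)

split : ∀ m n a b c → SplitsOff m n a b c
split zero n a b c p = record
  { a₁ = 0 ; b₁ = 0 ; c₁ = 0 ; a₂ = a ; b₂ = b ; c₂ = c
  ; first = record { total = refl ; a≤ = z≤n ; b≤ = z≤n ; c≤ = z≤n } ; second = p
  ; sum-a = refl ; sum-b = refl ; sum-c = refl }
split (suc zero) n = splitsOff-wlog-sorted split-off-largest
split (suc (suc m)) n a b c p = split-after-pair P (split m n _ _ _ (Split.second P))
  where
  P : Split 2 (m + n) a b c
  P = splitsOff-wlog-sorted split-off-two-largest a b c p

PalettePartition : ∀ {s} → (Fin s → ℕ) → ℕ → ℕ → ℕ → Set
PalettePartition {s} ks a b c =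
  Σ (Fin s → ℕ) λ as → Σ (Fin s → ℕ) λ bs → Σ (Fin s → ℕ) λ cs →
    (∀ i → UniformPalette (ks i) (as i) (bs i) (cs i)) ×
    (sumFin as ≡ a) × (sumFin bs ≡ b) × (sumFin cs ≡ c)

partition-step : ∀ {s} (ks : Fin (suc s) → ℕ) {a b c}
  (S : Split (ks Fin.zero) (sumFin (ks ∘ Fin.suc)) a b c) →
  PalettePartition (ks ∘ Fin.suc) (Split.a₂ S) (Split.b₂ S) (Split.c₂ S) →
  PalettePartition ks a b c
partition-step ks S (as , bs , cs , uniform , Σas , Σbs , Σcs) =
  a₁ ∷ as , b₁ ∷ bs , c₁ ∷ cs , parts ,
  trans (cong (a₁ +_) Σas) sum-a , trans (cong (b₁ +_) Σbs) sum-b , trans (cong (c₁ +_) Σcs) sum-c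
  where
  open Split S
  parts : ∀ i → UniformPalette (ks i) ((a₁ ∷ as) i) ((b₁ ∷ bs) i) ((c₁ ∷ cs) i)
  parts Fin.zero    = first
  parts (Fin.suc i) = uniform i

uniform-partition : ∀ {s} (ks : Fin s → ℕ) {a b c} →
  UniformPalette (sumFin ks) a b c → PalettePartition ks a b c
uniform-partition {zero} ks p with palette-zero p
... | refl , refl , refl = (λ ()) , (λ ()) , (λ ()) , (λ ()) , refl , refl , refl
uniform-partition {suc s} ks {a} {b} {c} p =
  partition-step ks S (uniform-partition (ks ∘ Fin.suc) (Split.second S))
  where
  S : Split (ks Fin.zero) (sumFin (ks ∘ Fin.suc)) a b c
  S = split _ _ a b c p

lemma1p2 : (s : ℕ) → 2 ≤ s → (ks : Fin s → ℕ) → (∀ i → 0 < ks i) →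
    (a b c : ℕ) → UniformPalette (sumFin ks) a b c →
    Σ (Fin s → ℕ) λ as → Σ (Fin s → ℕ) λ bs → Σ (Fin s → ℕ) λ cs →
      (∀ i → UniformPalette (ks i) (as i) (bs i) (cs i)) ×
      (sumFin as ≡ a) × (sumFin bs ≡ b) × (sumFin cs ≡ c)
lemma1p2 _ _ ks _ _ _ _ = uniform-partition ks
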